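{- Let $a,b$ be integers satisfying one of the following: (2a) $a \equiv b \equiv 1 \pmod 3$; (2b) $a \equiv 2 \pmod 3$ and $b \equiv 0 \pmod 3$; (2c) $a \equiv 1 \pmod 3$ and $b \equiv 0 \pmod 3$. Let $T_2 = \{\alpha \in LQ_{a,b} \mid 2 \nmid \alpha_0,\ 3 \nmid \alpha_1\alpha_3,\ 3 \mid \alpha_2\}$, $T_3 = \{\alpha \in LQ_{a,b} \mid 2 \nmid \alpha_0,\ 3 \nmid \alpha_1\alpha_2,\ 3 \mid \alpha_3\}$, and $T = T_2 \cup T_3$, where $\alpha = \alpha_0 + \alpha_1\mathbf{i} + \alpha_2\mathbf{j} + \alpha_3\mathbf{k}$. Then for every $\alpha \in T$ there exists $x \in LQ_{a,b}$ such that $\mathrm{Re}(x^3) \equiv \mathrm{Re}(\alpha) \pmod 3$ and $\mathrm{Im}(x^3) \equiv \mathrm{Im}(\alpha) \pmod 6$.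
   Context: For integers $a,b$, $LQ_{a,b}$ denotes the quaternion ring $\{\alpha_0 + \alpha_1 \mathbf{i} + \alpha_2 \mathbf{j} + \alpha_3 \mathbf{k} \mid \alpha_n \in \mathbb{Z}\}$ with multiplication determined by $\mathbf{i}^2 = -a$, $\mathbf{j}^2 = -b$, $\mathbf{i}\mathbf{j} = -\mathbf{j}\mathbf{i} = \mathbf{k}$. For $x = x_0 + x_1\mathbf{i} + x_2\mathbf{j} + x_3\mathbf{k}$, $\mathrm{Re}(x) = x_0$ and $\mathrm{Im}(x) = x_1\mathbf{i} + x_2\mathbf{j} + x_3\mathbf{k}$. We write $\mathrm{Im}(x) \equiv \mathrm{Im}(y) \pmod 6$ if $6$ divides each of the coefficients of $\mathrm{Im}(x-y)$. -}

module Defs where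

open import Data.Integer using (ℤ; _+_; _*_; _-_; -_; +_)
open import Data.Integer.Divisibility using (_∣_)
open import Data.Product using (_×_)
open import Data.Sum using (_⊎_)
open import Relation.Nullary using (¬_)
open import Relation.Binary.PropositionalEquality using (_≡_)

-- An element α₀ + α₁ i + α₂ j + α₃ k of LQ_{a,b} (integer coefficients).
record LQ : Set where
  constructor quat
  field
    re : ℤ
    c1 : ℤ
    c2 : ℤ
    c3 : ℤ
open LQ public

-- Multiplication in LQ_{a,b}: i² = -a, j² = -b, ij = -ji = k
-- (hence k² = -ab, ik = -a j, ki = a j, jk = b i, kj = -b i).
mulQ : ℤ → ℤ → LQ → LQ → LQ
mulQ a b (quat x0 x1 x2 x3) (quat y0 y1 y2 y3) =
  quat (x0 * y0 - a * (x1 * y1) - b * (x2 * y2) - a * b * (x3 * y3))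
       (x0 * y1 + x1 * y0 + b * (x2 * y3 - x3 * y2))
       (x0 * y2 + x2 * y0 + a * (x3 * y1 - x1 * y3))
       (x0 * y3 + x3 * y0 + x1 * y2 - x2 * y1)

cube : ℤ → ℤ → LQ → LQ
cube a b x = mulQ a b (mulQ a b x x) x

_≡[_]_ : ℤ → ℤ → ℤ → Set
infix 4 _≡[_]_
x ≡[ m ] y = m ∣ (x - y)

ReCong3 : LQ → LQ → Set
ReCong3 x y = re x ≡[ + 3 ] re y

ImCong6 : LQ → LQ → Set
ImCong6 x y = (c1 x ≡[ + 6 ] c1 y) × (c2 x ≡[ + 6 ] c2 y) × (c3 x ≡[ + 6 ] c3 y)

Cond2 : ℤ → ℤ → Set
Cond2 a b = ((a ≡[ + 3 ] + 1) × (b ≡[ + 3 ] + 1))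
          ⊎ ((a ≡[ + 3 ] + 2) × (b ≡[ + 3 ] + 0))
          ⊎ ((a ≡[ + 3 ] + 1) × (b ≡[ + 3 ] + 0))

T₂ : LQ → Set
T₂ α = (¬ (+ 2 ∣ re α)) × (¬ (+ 3 ∣ c1 α * c3 α)) × (+ 3 ∣ c2 α)

T₃ : LQ → Set
T₃ α = (¬ (+ 2 ∣ re α)) × (¬ (+ 3 ∣ c1 α * c2 α)) × (+ 3 ∣ c3 α)

T : LQ → Set
T α = T₂ α ⊎ T₃ α

module Submission where

-- Write α = a₀ + y with y = Im α and let N = a y₁² + b y₂² + ab y₃²
-- be the norm of y, so that y² = -N.  Quaternions of the form p + s·y all lie
-- in the commutative subring ℤ[y] ≅ ℤ[t]/(t² + N); in particular
--   (x₀ + s·y)³ = (x₀³ - 3x₀s²N) + (3x₀² - s²N)s · y.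
-- Choosing x₀ = a₀ + 3s²N makes the real part ≡ x₀³ ≡ x₀ ≡ a₀ (mod 3), and
-- the scalar C = (3x₀² - s²N)s is ≡ 1 (mod 6) as soon as a₀ and s are odd and
-- sN ≡ -1 (mod 3); then Im(x³) = C·y ≡ y (mod 6).
-- The hypotheses (2a)-(2c) together with α ∈ T force N ≡ 2 (mod 3) in cases
-- (2a), (2b) and N ≡ 1 (mod 3) in case (2c), so s = 1 resp. s = -1 works.

open import Defs
open import Data.Integer using (ℤ; _+_; _*_; _-_; -_; +_)
open import Data.Integer.Properties using (+-identityʳ; *-identityˡ)
open import Data.Integer.DivMod using (_%ℕ_; _/ℕ_; n%ℕd<d; a≡a%ℕn+[a/ℕn]*n)
open import Data.Integer.Divisibility.Signed
  using (_∣_; divides; ∣-refl; ∣ᵤ⇒∣; ∣⇒∣ᵤ; ∣m∣n⇒∣m+n; ∣m⇒∣-m; ∣m⇒∣m*n; ∣n⇒∣m*n)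
import Data.Integer.Divisibility as Unsigned
open import Data.Integer.Tactic.RingSolver using (solve-∀)
open import Data.Nat as ℕ using (s≤s)
open import Data.Product using (Σ; _,_; _×_)
open import Data.Sum using (_⊎_; inj₁; inj₂)
open import Data.Empty using (⊥-elim)
open import Relation.Nullary using (¬_)
open import Level using (0ℓ)
open import Relation.Binary.Bundles using (Setoid)
open import Relation.Binary.PropositionalEquality
  using (_≡_; refl; sym; trans; cong; cong₂; subst; module ≡-Reasoning)

-- Congruence modulo m, stated with signed divisibility.  It is a record (not
-- a definition) so that x and y can be inferred from the type.
record _≈_[mod_] (x y m : ℤ) : Set where
  constructor mod
  field divisible : m ∣ x - y

infix 4 _≈_[mod_]

∣-by : ∀ {m x y} → x ≡ y → m ∣ y → m ∣ x
∣-by {m} eq = subst (m ∣_) (sym eq)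

≈-reflexive : ∀ {m x y} → x ≡ y → x ≈ y [mod m ]
≈-reflexive {x = x} refl = mod (divides (+ 0) (x-x≡0 x))
  where
  x-x≡0 : ∀ x → x - x ≡ + 0
  x-x≡0 = solve-∀

≈-refl : ∀ {m x} → x ≈ x [mod m ]
≈-refl = ≈-reflexive refl

≈-sym : ∀ {m x y} → x ≈ y [mod m ] → y ≈ x [mod m ]
≈-sym {x = x} {y} (mod h) = mod (∣-by (flip x y) (∣m⇒∣-m h))
  where
  flip : ∀ x y → y - x ≡ - (x - y)
  flip = solve-∀

≈-trans : ∀ {m x y z} → x ≈ y [mod m ] → y ≈ z [mod m ] → x ≈ z [mod m ]
≈-trans {x = x} {y} {z} (mod h) (mod k) = mod (∣-by (split x y z) (∣m∣n⇒∣m+n h k))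
  where
  split : ∀ x y z → x - z ≡ (x - y) + (y - z)
  split = solve-∀

mod-setoid : ℤ → Setoid 0ℓ 0ℓ
mod-setoid m = record
  { Carrier       = ℤ
  ; _≈_           = λ x y → x ≈ y [mod m ]
  ; isEquivalence = record { refl = ≈-refl ; sym = ≈-sym ; trans = ≈-trans }
  }

module ≈-Reasoning (m : ℤ) where
  open import Relation.Binary.Reasoning.Setoid (mod-setoid m) public

+-cong : ∀ {m x y u v} → x ≈ y [mod m ] → u ≈ v [mod m ] → x + u ≈ y + v [mod m ]
+-cong {x = x} {y} {u} {v} (mod h) (mod k) = mod (∣-by (regroup x y u v) (∣m∣n⇒∣m+n h k))
  where
  regroup : ∀ x y u v → (x + u) - (y + v) ≡ (x - y) + (u - v)
  regroup = solve-∀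

neg-cong : ∀ {m x y} → x ≈ y [mod m ] → - x ≈ - y [mod m ]
neg-cong {x = x} {y} (mod h) = mod (∣-by (regroup x y) (∣m⇒∣-m h))
  where
  regroup : ∀ x y → - x - - y ≡ - (x - y)
  regroup = solve-∀

*-cong : ∀ {m x y u v} → x ≈ y [mod m ] → u ≈ v [mod m ] → x * u ≈ y * v [mod m ]
*-cong {x = x} {y} {u} {v} (mod h) (mod k) =
  mod (∣-by (regroup x y u v) (∣m∣n⇒∣m+n (∣m⇒∣m*n u h) (∣n⇒∣m*n y k)))
  where
  regroup : ∀ x y u v → x * u - y * v ≡ (x - y) * u + y * (u - v)
  regroup = solve-∀

+-multiple : ∀ {m k} x → m ∣ k → x + k ≈ x [mod m ]
+-multiple {k = k} x h = mod (∣-by (cancel x k) h)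
  where
  cancel : ∀ x k → (x + k) - x ≡ k
  cancel = solve-∀

≈0⇒∣ : ∀ {m x} → x ≈ + 0 [mod m ] → m ∣ x
≈0⇒∣ {x = x} (mod h) = ∣-by (sym (+-identityʳ x)) h

≈-remainder : ∀ n m .{{_ : ℕ.NonZero m}} → n ≈ + (n %ℕ m) [mod + m ]
≈-remainder n m =
  mod (divides (n /ℕ m) (trans (cong (_- r) (a≡a%ℕn+[a/ℕn]*n n m)) (cancel r (n /ℕ m) (+ m))))
  where
  r : ℤ
  r = + (n %ℕ m)
  cancel : ∀ r q m → (r + q * m) - r ≡ q * m
  cancel = solve-∀

residue-mod2 : ∀ n → n ≈ + 0 [mod + 2 ] ⊎ n ≈ + 1 [mod + 2 ]
residue-mod2 n with n %ℕ 2 | n%ℕd<d n 2 | ≈-remainder n 2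
... | 0 | _ | h = inj₁ h
... | 1 | _ | h = inj₂ h
... | ℕ.suc (ℕ.suc _) | s≤s (s≤s ()) | _

residue-mod3 : ∀ n → n ≈ + 0 [mod + 3 ] ⊎ n ≈ + 1 [mod + 3 ] ⊎ n ≈ + 2 [mod + 3 ]
residue-mod3 n with n %ℕ 3 | n%ℕd<d n 3 | ≈-remainder n 3
... | 0 | _ | h = inj₁ h
... | 1 | _ | h = inj₂ (inj₁ h)
... | 2 | _ | h = inj₂ (inj₂ h)
... | ℕ.suc (ℕ.suc (ℕ.suc _)) | s≤s (s≤s (s≤s ())) | _

square≈-mod2 : ∀ n → n * n ≈ n [mod + 2 ]
square≈-mod2 n with residue-mod2 n
... | inj₁ h = ≈-trans (*-cong h h) (≈-sym h)
... | inj₂ h = ≈-trans (*-cong h h) (≈-sym h)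

cube≈-mod3 : ∀ n → n * n * n ≈ n [mod + 3 ]
cube≈-mod3 n with residue-mod3 n
... | inj₁ h        = ≈-trans (*-cong (*-cong h h) h) (≈-sym h)
... | inj₂ (inj₁ h) = ≈-trans (*-cong (*-cong h h) h) (≈-sym h)
... | inj₂ (inj₂ h) = ≈-trans (*-cong (*-cong h h) h) (≈-trans (mod (divides (+ 2) refl)) (≈-sym h))

unit-square-mod3 : ∀ n → ¬ (+ 3 ∣ n) → n * n ≈ + 1 [mod + 3 ]
unit-square-mod3 n n∤ with residue-mod3 n
... | inj₁ h        = ⊥-elim (n∤ (≈0⇒∣ h))
... | inj₂ (inj₁ h) = *-cong h h
... | inj₂ (inj₂ h) = ≈-trans (*-cong h h) (mod (divides (+ 1) refl))

odd⇒≈1 : ∀ n → ¬ (+ 2 ∣ n) → n ≈ + 1 [mod + 2 ]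
odd⇒≈1 n n∤ with residue-mod2 n
... | inj₁ h = ⊥-elim (n∤ (≈0⇒∣ h))
... | inj₂ h = h

≈-mod6 : ∀ {x y} → x ≈ y [mod + 2 ] → x ≈ y [mod + 3 ] → x ≈ y [mod + 6 ]
≈-mod6 {x} {y} (mod (divides u eu)) (mod (divides v ev)) = mod (divides (u - v) (begin
    x - y                         ≡⟨ thrice-minus-twice (x - y) ⟩
    (x - y) * + 3 - (x - y) * + 2 ≡⟨ cong₂ (λ e f → e * + 3 - f * + 2) eu ev ⟩
    u * + 2 * + 3 - v * + 3 * + 2 ≡⟨ collect u v ⟩
    (u - v) * + 6                 ∎))
  where
  open ≡-Reasoning
  thrice-minus-twice : ∀ e → e ≡ e * + 3 - e * + 2
  thrice-minus-twice = solve-∀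
  collect : ∀ u v → u * + 2 * + 3 - v * + 3 * + 2 ≡ (u - v) * + 6
  collect = solve-∀

≈⇒≡[mod] : ∀ {m x y} → x ≈ y [mod m ] → x ≡[ m ] y
≈⇒≡[mod] (mod h) = ∣⇒∣ᵤ h

≡[mod]⇒≈ : ∀ {m} x y → x ≡[ m ] y → x ≈ y [mod m ]
≡[mod]⇒≈ {m} x y h = mod (∣ᵤ⇒∣ {m} {x - y} h)

_⊕_·_ : ℤ → ℤ → LQ → LQ
p ⊕ s · y = quat p (s * c1 y) (s * c2 y) (s * c3 y)

infix 5 _⊕_·_

-- N(y) = a y₁² + b y₂² + ab y₃², so that (Im y)² = -N(y).
normIm : ℤ → ℤ → LQ → ℤ
normIm a b y = a * (c1 y * c1 y) + b * (c2 y * c2 y) + a * b * (c3 y * c3 y)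

quat-cong : ∀ {x0 x1 x2 x3 y0 y1 y2 y3} →
  x0 ≡ y0 → x1 ≡ y1 → x2 ≡ y2 → x3 ≡ y3 → quat x0 x1 x2 x3 ≡ quat y0 y1 y2 y3
quat-cong refl refl refl refl = refl

mul-parallel : ∀ a b p s q t y →
  mulQ a b (p ⊕ s · y) (q ⊕ t · y) ≡ p * q - s * t * normIm a b y ⊕ p * t + s * q · y
mul-parallel a b p s q t (quat _ y1 y2 y3) =
  quat-cong (real a b p s q t y1 y2 y3) (imag₁ b p s q t y1 y2 y3)
            (imag₂ a p s q t y1 y2 y3) (imag₃ p s q t y1 y2 y3)
  where
  real : ∀ a b p s q t y1 y2 y3 →
    p * q - a * (s * y1 * (t * y1)) - b * (s * y2 * (t * y2)) - a * b * (s * y3 * (t * y3))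
      ≡ p * q - s * t * (a * (y1 * y1) + b * (y2 * y2) + a * b * (y3 * y3))
  real = solve-∀
  imag₁ : ∀ b p s q t y1 y2 y3 →
    p * (t * y1) + s * y1 * q + b * (s * y2 * (t * y3) - s * y3 * (t * y2)) ≡ (p * t + s * q) * y1
  imag₁ = solve-∀
  imag₂ : ∀ a p s q t y1 y2 y3 →
    p * (t * y2) + s * y2 * q + a * (s * y3 * (t * y1) - s * y1 * (t * y3)) ≡ (p * t + s * q) * y2
  imag₂ = solve-∀
  imag₃ : ∀ p s q t y1 y2 y3 →
    p * (t * y3) + s * y3 * q + s * y1 * (t * y2) - s * y2 * (t * y1) ≡ (p * t + s * q) * y3
  imag₃ = solve-∀

cube-parallel : ∀ a b p s y → let M = s * s * normIm a b y in
  cube a b (p ⊕ s · y) ≡ p * p * p - + 3 * p * M ⊕ (+ 3 * p * p - M) * s · y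
cube-parallel a b p s y = begin
  mulQ a b (mulQ a b x x) x
    ≡⟨ cong (λ z → mulQ a b z x) (mul-parallel a b p s p s y) ⟩
  mulQ a b (p * p - s * s * N ⊕ p * s + s * p · y) x
    ≡⟨ mul-parallel a b (p * p - s * s * N) (p * s + s * p) p s y ⟩
  (p * p - s * s * N) * p - (p * s + s * p) * s * N ⊕ (p * p - s * s * N) * s + (p * s + s * p) * p · y
    ≡⟨ cong₂ (λ u v → u ⊕ v · y) (real p s N) (imag p s N) ⟩
  p * p * p - + 3 * p * (s * s * N) ⊕ (+ 3 * p * p - s * s * N) * s · y ∎
  where
  open ≡-Reasoning
  x : LQ
  x = p ⊕ s · y
  N : ℤ
  N = normIm a b y
  real : ∀ p s N → (p * p - s * s * N) * p - (p * s + s * p) * s * N ≡ p * p * p - + 3 * p * (s * s * N)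
  real = solve-∀
  imag : ∀ p s N → (p * p - s * s * N) * s + (p * s + s * p) * p ≡ (+ 3 * p * p - s * s * N) * s
  imag = solve-∀

real-part≈ : ∀ a0 M → let x0 = a0 + + 3 * M in
  x0 * x0 * x0 - + 3 * x0 * M ≈ a0 [mod + 3 ]
real-part≈ a0 M = begin
  x0 * x0 * x0 - + 3 * x0 * M ≈⟨ +-multiple (x0 * x0 * x0) (∣m⇒∣-m (∣m⇒∣m*n M (∣m⇒∣m*n x0 ∣-refl))) ⟩
  x0 * x0 * x0                ≈⟨ cube≈-mod3 x0 ⟩
  a0 + + 3 * M                ≈⟨ +-multiple a0 (∣m⇒∣m*n M ∣-refl) ⟩
  a0                          ∎
  where
  open ≈-Reasoning (+ 3)
  x0 : ℤ
  x0 = a0 + + 3 * M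

imag-scalar≈1 : ∀ a0 s N → let M = s * s * N ; x0 = a0 + + 3 * M in
  a0 ≈ + 1 [mod + 2 ] → s ≈ + 1 [mod + 2 ] → s * N ≈ - + 1 [mod + 3 ] →
  (+ 3 * x0 * x0 - M) * s ≈ + 1 [mod + 6 ]
imag-scalar≈1 a0 s N a0-odd s-odd sN≈-1 = ≈-mod6 (*-cong scalar-odd s-odd) scalar≈1-mod3
  where
  M x0 : ℤ
  M = s * s * N
  x0 = a0 + + 3 * M

  scalar-odd : + 3 * x0 * x0 - M ≈ + 1 [mod + 2 ]
  scalar-odd = begin
    + 3 * x0 * x0 - M             ≡⟨ split-off-even x0 M ⟩
    x0 * x0 - M + + 2 * (x0 * x0) ≈⟨ +-multiple (x0 * x0 - M) (∣m⇒∣m*n (x0 * x0) ∣-refl) ⟩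
    x0 * x0 - M                   ≈⟨ +-cong (square≈-mod2 x0) ≈-refl ⟩
    x0 - M                        ≡⟨ unfold-x0 a0 M ⟩
    a0 + + 2 * M                  ≈⟨ +-multiple a0 (∣m⇒∣m*n M ∣-refl) ⟩
    a0                            ≈⟨ a0-odd ⟩
    + 1                           ∎
    where
    open ≈-Reasoning (+ 2)
    split-off-even : ∀ x0 M → + 3 * x0 * x0 - M ≡ x0 * x0 - M + + 2 * (x0 * x0)
    split-off-even = solve-∀
    unfold-x0 : ∀ a0 M → a0 + + 3 * M - M ≡ a0 + + 2 * M
    unfold-x0 = solve-∀

  scalar≈1-mod3 : (+ 3 * x0 * x0 - M) * s ≈ + 1 [mod + 3 ]
  scalar≈1-mod3 = begin
    (+ 3 * x0 * x0 - M) * s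
      ≡⟨ expand x0 s N ⟩
    - (s * s * s * N) + + 3 * (x0 * x0 * s)
      ≈⟨ +-multiple (- (s * s * s * N)) (∣m⇒∣m*n (x0 * x0 * s) ∣-refl) ⟩
    - (s * s * s * N)
      ≈⟨ neg-cong (*-cong (cube≈-mod3 s) ≈-refl) ⟩
    - (s * N)
      ≈⟨ neg-cong sN≈-1 ⟩
    + 1 ∎
    where
    open ≈-Reasoning (+ 3)
    expand : ∀ x0 s N → (+ 3 * x0 * x0 - s * s * N) * s ≡ - (s * s * s * N) + + 3 * (x0 * x0 * s)
    expand = solve-∀

scale-by-one : ∀ {m C} y → C ≈ + 1 [mod m ] → C * y ≈ y [mod m ]
scale-by-one y C≈1 = ≈-trans (*-cong C≈1 ≈-refl) (≈-reflexive (*-identityˡ y))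

cube-root : ∀ a b α s → re α ≈ + 1 [mod + 2 ] → s ≈ + 1 [mod + 2 ] →
  s * normIm a b α ≈ - + 1 [mod + 3 ] →
  Σ LQ (λ x → ReCong3 (cube a b x) α × ImCong6 (cube a b x) α)
cube-root a b α s re-odd s-odd sN≈-1 = x , subst Close (sym (cube-parallel a b x0 s α))
  ( ≈⇒≡[mod] (real-part≈ (re α) M)
  , ≈⇒≡[mod] (scale-by-one (c1 α) C≈1)
  , ≈⇒≡[mod] (scale-by-one (c2 α) C≈1)
  , ≈⇒≡[mod] (scale-by-one (c3 α) C≈1) )
  where
  M x0 : ℤ
  M = s * s * normIm a b α
  x0 = re α + + 3 * M
  x : LQ
  x = x0 ⊕ s · α
  Close : LQ → Set
  Close z = ReCong3 z α × ImCong6 z α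
  C≈1 : (+ 3 * x0 * x0 - M) * s ≈ + 1 [mod + 6 ]
  C≈1 = imag-scalar≈1 (re α) s (normIm a b α) re-odd s-odd sN≈-1

SquaresMod3 : ℤ → ℤ → ℤ → LQ → Set
SquaresMod3 e1 e2 e3 α =
  (c1 α * c1 α ≈ e1 [mod + 3 ]) × (c2 α * c2 α ≈ e2 [mod + 3 ]) × (c3 α * c3 α ≈ e3 [mod + 3 ])

coprime-factors : ∀ {m} x y → ¬ (m Unsigned.∣ x * y) → ¬ (m ∣ x) × ¬ (m ∣ y)
coprime-factors x y m∤xy = (λ m∣x → m∤xy (∣⇒∣ᵤ (∣m⇒∣m*n y m∣x)))
                         , (λ m∣y → m∤xy (∣⇒∣ᵤ (∣n⇒∣m*n x m∣y)))

square≈0 : ∀ {m} y → m Unsigned.∣ y → y * y ≈ + 0 [mod m ]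
square≈0 {m} y m∣y = mod (∣-by (+-identityʳ (y * y)) (∣m⇒∣m*n y (∣ᵤ⇒∣ {m} {y} m∣y)))

T-squares : ∀ α → T α → SquaresMod3 (+ 1) (+ 0) (+ 1) α ⊎ SquaresMod3 (+ 1) (+ 1) (+ 0) α
T-squares (quat _ y1 y2 y3) (inj₁ (_ , 3∤y1y3 , 3∣y2)) with coprime-factors y1 y3 3∤y1y3
... | 3∤y1 , 3∤y3 = inj₁ (unit-square-mod3 y1 3∤y1 , square≈0 y2 3∣y2 , unit-square-mod3 y3 3∤y3)
T-squares (quat _ y1 y2 y3) (inj₂ (_ , 3∤y1y2 , 3∣y3)) with coprime-factors y1 y2 3∤y1y2
... | 3∤y1 , 3∤y2 = inj₂ (unit-square-mod3 y1 3∤y1 , unit-square-mod3 y2 3∤y2 , square≈0 y3 3∣y3)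

T-re-odd : ∀ α → T α → re α ≈ + 1 [mod + 2 ]
T-re-odd α t = odd⇒≈1 (re α) (λ 2∣re → re-odd t (∣⇒∣ᵤ 2∣re))
  where
  re-odd : T α → ¬ (+ 2 Unsigned.∣ re α)
  re-odd (inj₁ (odd , _)) = odd
  re-odd (inj₂ (odd , _)) = odd

normIm-mod3 : ∀ {a b a' b' e1 e2 e3} y → a ≈ a' [mod + 3 ] → b ≈ b' [mod + 3 ] →
  SquaresMod3 e1 e2 e3 y → normIm a b y ≈ a' * e1 + b' * e2 + a' * b' * e3 [mod + 3 ]
normIm-mod3 _ a≈ b≈ (sq1 , sq2 , sq3) =
  +-cong (+-cong (*-cong a≈ sq1) (*-cong b≈ sq2)) (*-cong (*-cong a≈ b≈) sq3)

Cond2≈ : ℤ → ℤ → Set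
Cond2≈ a b = (a ≈ + 1 [mod + 3 ] × b ≈ + 1 [mod + 3 ])
           ⊎ (a ≈ + 2 [mod + 3 ] × b ≈ + 0 [mod + 3 ])
           ⊎ (a ≈ + 1 [mod + 3 ] × b ≈ + 0 [mod + 3 ])

Cond2⇒Cond2≈ : ∀ a b → Cond2 a b → Cond2≈ a b
Cond2⇒Cond2≈ a b (inj₁ (ha , hb)) = inj₁ (≡[mod]⇒≈ a (+ 1) ha , ≡[mod]⇒≈ b (+ 1) hb)
Cond2⇒Cond2≈ a b (inj₂ (inj₁ (ha , hb))) = inj₂ (inj₁ (≡[mod]⇒≈ a (+ 2) ha , ≡[mod]⇒≈ b (+ 0) hb))
Cond2⇒Cond2≈ a b (inj₂ (inj₂ (ha , hb))) = inj₂ (inj₂ (≡[mod]⇒≈ a (+ 1) ha , ≡[mod]⇒≈ b (+ 0) hb))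

OddSign : ℤ → ℤ → LQ → Set
OddSign a b α = Σ ℤ (λ s → s ≈ + 1 [mod + 2 ] × s * normIm a b α ≈ - + 1 [mod + 3 ])

sign-for-norm≈2 : ∀ {N} → N ≈ + 2 [mod + 3 ] → + 1 * N ≈ - + 1 [mod + 3 ]
sign-for-norm≈2 N≈2 = ≈-trans (*-cong (≈-refl {x = + 1}) N≈2) (mod (divides (+ 1) refl))

sign-for-norm≈1 : ∀ {N} → N ≈ + 1 [mod + 3 ] → - + 1 * N ≈ - + 1 [mod + 3 ]
sign-for-norm≈1 N≈1 = *-cong (≈-refl {x = - + 1}) N≈1

minus-one-odd : - + 1 ≈ + 1 [mod + 2 ]
minus-one-odd = mod (divides (- + 1) refl)

odd-sign : ∀ a b α → Cond2 a b → T α → OddSign a b α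
odd-sign a b α cond t with Cond2⇒Cond2≈ a b cond | T-squares α t
... | inj₁ (a≈1 , b≈1)        | inj₁ sq = + 1 , ≈-refl , sign-for-norm≈2 (normIm-mod3 α a≈1 b≈1 sq)
... | inj₁ (a≈1 , b≈1)        | inj₂ sq = + 1 , ≈-refl , sign-for-norm≈2 (normIm-mod3 α a≈1 b≈1 sq)
... | inj₂ (inj₁ (a≈2 , b≈0)) | inj₁ sq = + 1 , ≈-refl , sign-for-norm≈2 (normIm-mod3 α a≈2 b≈0 sq)
... | inj₂ (inj₁ (a≈2 , b≈0)) | inj₂ sq = + 1 , ≈-refl , sign-for-norm≈2 (normIm-mod3 α a≈2 b≈0 sq)
... | inj₂ (inj₂ (a≈1 , b≈0)) | inj₁ sq = - + 1 , minus-one-odd , sign-for-norm≈1 (normIm-mod3 α a≈1 b≈0 sq)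
... | inj₂ (inj₂ (a≈1 , b≈0)) | inj₂ sq = - + 1 , minus-one-odd , sign-for-norm≈1 (normIm-mod3 α a≈1 b≈0 sq)

mainTheorem6 : (a b : ℤ) → Cond2 a b → (α : LQ) → T α →
    Σ LQ (λ x → ReCong3 (cube a b x) α × ImCong6 (cube a b x) α)
mainTheorem6 a b cond α t with odd-sign a b α cond t
... | s , s-odd , sN≈-1 = cube-root a b α s (T-re-odd α t) s-odd sN≈-1
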